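{- Let $G\in\mathcal{G}(\widehat{C}_6,\widehat{C}_7)$, let $x\in V(G)$, let $A$ be a connected component of $H_x[N_2(x)]$, and let $a,b$ be two adjacent vertices of $A$. If $N(a)\cap N(x)=\{v_1,\dots,v_k\}$ with $k>2$, then $N(\{v_1,\dots,v_k\})\cap N_2(x)=\{a\}$.
   Context: Graphs are finite, simple, undirected. $\mathcal{G}(\widehat{C}_6,\widehat{C}_7)$ is the class of graphs containing no (not necessarily induced) subgraph isomorphic to $C_6$ or $C_7$. For a nonempty vertex set $S$, $N(S)$ (resp. $N[S]$) is the set of vertices at distance exactly $1$ (resp. at most $1$) from $S$; $N_2(x)$ (resp. $N_2[x]$) the set at distance exactly $2$ (resp. at most $2$) from $x$; $N[\emptyset]=\emptyset$. Construction of $H_x$ (neighborhoods in $G$): let $A^*$ be the set of all connected components $A'$ of $G[N_2(x)]$ for which some $a'\in V(A')$ satisfies $N(x)\cap N(a')=N(x)\cap N(V(A'))$, let $V(A^*)$ be the union of their vertex sets, and $H_x=G[N_2[x]\setminus N[V(A^*)]]$. In the claim itself, all neighborhoods $N(\cdot)$ and $N_2(x)$ are taken in the graph $H_x$. -}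

module Defs where

open import Data.Nat using (ℕ; zero; suc)
open import Data.Fin using (Fin; toℕ)
open import Data.Product using (_×_; ∃; Σ)
open import Data.Sum using (_⊎_)
open import Data.Unit using (⊤)
open import Relation.Nullary using (¬_)
open import Relation.Binary.PropositionalEquality using (_≡_; _≢_)
open import Function.Bundles using (_⇔_)
open import Function.Definitions using (Injective)

record Graph (n : ℕ) : Set₁ where
  field
    E      : Fin n → Fin n → Set
    sym    : ∀ {u v} → E u v → E v u
    irrefl : ∀ {u} → ¬ E u u

module _ {n : ℕ} where

  VSet : Set₁
  VSet = Fin n → Set

  Rel : Set₁
  Rel = Fin n → Fin n → Set

  All : VSet
  All _ = ⊤

  -- G contains a (not necessarily induced) cycle of length k (k ≥ 3 intended):
  -- an injective map f : Fin k → Fin n with f i ~ f (i+1 mod k).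
  HasCycle : Rel → ℕ → Set
  HasCycle E k = Σ (Fin k → Fin n) λ f → Injective _≡_ _≡_ f ×
    (∀ (i j : Fin k) → (suc (toℕ i) ≡ toℕ j ⊎ (suc (toℕ i) ≡ k × toℕ j ≡ 0)) → E (f i) (f j))

  -- Below, a graph is given by a vertex set V and an edge relation E
  -- (the graph G[V] induced by V).
  Adj : VSet → Rel → Rel
  Adj V E u v = V u × V v × E u v

  Nbr : VSet → Rel → VSet → VSet
  Nbr V E S y = V y × ¬ S y × ∃ λ s → S s × Adj V E s y

  NbrC : VSet → Rel → VSet → VSet
  NbrC V E S y = S y ⊎ Nbr V E S y

  N2 : VSet → Rel → Fin n → VSet
  N2 V E x y = V y × y ≢ x × ¬ Adj V E x y × ∃ λ z → Adj V E x z × Adj V E z y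

  N2C : VSet → Rel → Fin n → VSet
  N2C V E x y = (V y × y ≡ x) ⊎ Nbr V E (_≡ x) y ⊎ N2 V E x y

  data Reach (V : VSet) (E : Rel) (P : VSet) (u : Fin n) : Fin n → Set where
    here : P u → V u → Reach V E P u u
    step : ∀ {w v} → Reach V E P u w → Adj V E w v → P v → Reach V E P u v

  IsComponent : VSet → Rel → VSet → VSet → Set
  IsComponent V E P A = ∃ λ c → P c × V c × (∀ y → A y ⇔ Reach V E P c y)

  -- Construction of H_x (all neighbourhoods in G, i.e. V = All).
  module _ (E : Rel) (x : Fin n) where

    CompG : Fin n → VSet
    CompG c = Reach All E (N2 All E x) c

    -- the component CompG c belongs to A*: some a' in it has
    -- N(x) ∩ N(a') = N(x) ∩ N(V(A'))
    GoodComp : Fin n → Set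
    GoodComp c = ∃ λ a' → CompG c a' ×
      (∀ v → (Nbr All E (_≡ x) v × Nbr All E (_≡ a') v)
             ⇔ (Nbr All E (_≡ x) v × Nbr All E (CompG c) v))

    VAstar : VSet
    VAstar y = ∃ λ c → GoodComp c × CompG c y

    -- vertex set of H_x = G[N₂[x] \ N[V(A*)]]
    HV : VSet
    HV y = N2C All E x y × ¬ NbrC All E VAstar y

module Submission where

-- Work in G with all neighbourhoods taken in G, write N₂ for
-- N₂(x), and let a ∈ N₂ have at least three common neighbours with x, so
-- that x and a have a common neighbour avoiding any two given vertices.
-- Every forbidden configuration below is ruled out by exhibiting a 6- or
-- 7-cycle through x; 'closedWalk⇒cycle' turns a closed walk on distinct
-- vertices into such a cycle.
--   (1) The component of a in G[N₂] is a star centred at a.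
--   (2) Hence, if a neighbour p ∈ N₂ of a is adjacent to some common
--       neighbour v₁ of x and a, the component of a is good (it belongs
--       to A*, witnessed by a itself).
--   (3) If the component of a is not good and y ≠ a in N₂ is adjacent to
--       such a v₁, then v₁ is the only vertex of N(x) adjacent to the
--       component of y, so that component is good.
-- In H_x the vertex a survives, so its G-component is not good; any
-- y ≠ a in N(v_i) ∩ N₂ would by (3) lie in A* and not survive.  Hence
-- N({v_i}) ∩ N₂(x) = {a} in H_x.

open import Defs
open import Data.Nat using (ℕ; suc; _<_; z≤n; s≤s)
open import Data.Nat.Properties using (suc-injective; ≤-trans)
open import Data.Fin using (Fin; zero; suc; toℕ; fromℕ; fromℕ<)
open import Data.Fin.Properties using (_≟_; toℕ-injective; toℕ-fromℕ)
open import Data.List using (List; []; _∷_; length; lookup)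
open import Data.List.Membership.Propositional.Properties using (∈-lookup)
open import Data.List.Relation.Unary.All as All using ([]; _∷_)
open import Data.List.Relation.Unary.AllPairs using (AllPairs; []; _∷_)
open import Data.List.Relation.Unary.Linked using (Linked; [-]; _∷_)
open import Data.Product using (_×_; ∃; _,_; proj₁; proj₂)
open import Data.Sum using (_⊎_; inj₁; inj₂)
open import Data.Unit using (tt)
open import Data.Empty using (⊥; ⊥-elim)
open import Relation.Nullary using (¬_; yes; no)
open import Relation.Binary.PropositionalEquality
  using (_≡_; _≢_; refl; sym; trans; subst; cong; ≢-sym)
open import Function.Bundles using (_⇔_; mk⇔; Equivalence)
open import Function.Definitions using (Injective)

module _ {n : ℕ} where

  lookup-injective : {cs : List (Fin n)} → AllPairs _≢_ cs → Injective _≡_ _≡_ (lookup cs)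
  lookup-injective (_ ∷ _)   {zero}  {zero}  _  = refl
  lookup-injective (c≢ ∷ _)  {zero}  {suc j} eq = ⊥-elim (All.lookup c≢ (∈-lookup j) eq)
  lookup-injective (c≢ ∷ _)  {suc i} {zero}  eq = ⊥-elim (All.lookup c≢ (∈-lookup i) (sym eq))
  lookup-injective (_ ∷ cs≢) {suc i} {suc j} eq = cong suc (lookup-injective cs≢ eq)

  linked-consecutive : {E : Rel} {cs : List (Fin n)} → Linked E cs →
    ∀ i j → suc (toℕ i) ≡ toℕ j → E (lookup cs i) (lookup cs j)
  linked-consecutive (e ∷ _) zero    (suc zero)    _  = e
  linked-consecutive (_ ∷ w) (suc i) (suc j)       eq = linked-consecutive w i j (suc-injective eq)
  linked-consecutive [-]     zero    zero          ()
  linked-consecutive (_ ∷ _) zero    zero          ()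
  linked-consecutive (_ ∷ _) zero    (suc (suc _)) ()
  linked-consecutive (_ ∷ _) (suc _) zero          ()

  closedWalk⇒cycle : {E : Rel} (c : Fin n) (cs : List (Fin n)) →
    AllPairs _≢_ (c ∷ cs) → Linked E (c ∷ cs) →
    E (lookup (c ∷ cs) (fromℕ (length cs))) c → HasCycle E (length (c ∷ cs))
  closedWalk⇒cycle {E} c cs distinct walk closing =
    lookup (c ∷ cs) , lookup-injective distinct , edge
    where
    last-index : ∀ {i : Fin (suc (length cs))} → suc (toℕ i) ≡ suc (length cs) → i ≡ fromℕ (length cs)
    last-index i-last = toℕ-injective (trans (suc-injective i-last) (sym (toℕ-fromℕ (length cs))))

    edge : ∀ i j → suc (toℕ i) ≡ toℕ j ⊎ (suc (toℕ i) ≡ length (c ∷ cs) × toℕ j ≡ 0) →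
           E (lookup (c ∷ cs) i) (lookup (c ∷ cs) j)
    edge i j    (inj₁ consecutive) = linked-consecutive walk i j consecutive
    edge i zero (inj₂ (i-last , _)) rewrite last-index i-last = closing

  avoid-beside : ∀ {k} (v : Fin (suc (suc (suc k))) → Fin n) → Injective _≡_ _≡_ v →
    ∀ {γ} → v zero ≡ γ → ∀ δ → ∃ λ i → v i ≢ γ × v i ≢ δ
  avoid-beside v v-inj v₀≡γ δ with v (suc zero) ≟ δ
  ... | no v₁≢δ  = suc zero , (λ v₁≡γ → 1≢0 (v-inj (trans v₁≡γ (sym v₀≡γ)))) , v₁≢δ
    where 1≢0 : suc zero ≢ zero
          1≢0 ()
  ... | yes v₁≡δ = suc (suc zero) , (λ v₂≡γ → 2≢0 (v-inj (trans v₂≡γ (sym v₀≡γ))))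
                                  , (λ v₂≡δ → 2≢1 (v-inj (trans v₂≡δ (sym v₁≡δ))))
    where 2≢0 : suc (suc zero) ≢ zero
          2≢0 ()
          2≢1 : suc (suc zero) ≢ suc zero
          2≢1 ()

  avoid-two : ∀ {k} (v : Fin k → Fin n) → Injective _≡_ _≡_ v → 2 < k →
    ∀ α β → ∃ λ i → v i ≢ α × v i ≢ β
  avoid-two v v-inj (s≤s (s≤s (s≤s _))) α β with v zero ≟ α | v zero ≟ β
  ... | no v₀≢α  | no v₀≢β  = zero , v₀≢α , v₀≢β
  ... | yes v₀≡α | _        = avoid-beside v v-inj v₀≡α β
  ... | no _     | yes v₀≡β with avoid-beside v v-inj v₀≡β α
  ...   | i , vᵢ≢β , vᵢ≢α = i , vᵢ≢α , vᵢ≢β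

reach-end : ∀ {n} {V : VSet {n}} {E : Rel} {P : VSet} {u v : Fin n} → Reach V E P u v → P v
reach-end (here p _)   = p
reach-end (step _ _ p) = p

module Around {n : ℕ} (G : Graph n) (x : Fin n) where
  open Graph G using (E) renaming (sym to E-sym; irrefl to E-irrefl)

  Far : Fin n → Set
  Far = N2 All E x

  -- x and a have a common neighbour outside any two prescribed vertices
  -- (which holds as soon as they have three common neighbours).
  ManyCommon : Fin n → Set
  ManyCommon a = ∀ α β → ∃ λ t → E x t × E a t × t ≢ α × t ≢ β

  adj⇒≢ : ∀ {u v} → E u v → u ≢ v
  adj⇒≢ e refl = E-irrefl e

  far⇒¬near : ∀ {p} → Far p → ¬ E x p
  far⇒¬near (_ , _ , ¬x~p , _) exp = ¬x~p (tt , tt , exp)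

  x≢far : ∀ {p} → Far p → x ≢ p
  x≢far (_ , p≢x , _) = ≢-sym p≢x

  near≢far : ∀ {u p} → E x u → Far p → u ≢ p
  near≢far exu pFar refl = far⇒¬near pFar exu

  far≢near : ∀ {p u} → Far p → E x u → p ≢ u
  far≢near pFar exu = ≢-sym (near≢far exu pFar)

  far-contact : ∀ {p} → Far p → ∃ λ z → E x z × E z p
  far-contact (_ , _ , _ , z , (_ , _ , exz) , (_ , _ , ezp)) = z , exz , ezp

  near-of-Nbr : ∀ {v} → Nbr All E (_≡ x) v → E x v
  near-of-Nbr (_ , _ , _ , refl , (_ , _ , exv)) = exv

  good-by-root : ∀ {c} → Far c → (∀ {v r} → E x v → CompG E x c r → E r v → E c v) →
    GoodComp E x c
  good-by-root {c} cFar root-sees = c , here cFar tt , λ _ → mk⇔ to from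
    where
    to : ∀ {v} → Nbr All E (_≡ x) v × Nbr All E (_≡ c) v → Nbr All E (_≡ x) v × Nbr All E (CompG E x c) v
    to (x~v , (_ , _ , _ , refl , c~v)) =
      x~v , (tt , (λ cv → far⇒¬near (reach-end cv) (near-of-Nbr x~v)) , c , here cFar tt , c~v)
    from : ∀ {v} → Nbr All E (_≡ x) v × Nbr All E (CompG E x c) v → Nbr All E (_≡ x) v × Nbr All E (_≡ c) v
    from (x~v , (_ , _ , r , cr , (_ , _ , erv))) =
      x~v , (tt , (λ v≡c → far≢near cFar (near-of-Nbr x~v) (sym v≡c)) , c , refl ,
             (tt , tt , root-sees (near-of-Nbr x~v) cr erv))

  far-in-G : ∀ {p} → N2 (HV E x) E x p → Far p
  far-in-G (p∈H , p≢x , ¬x~p , z , (x∈H , _ , exz) , (_ , _ , ezp)) =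
    tt , p≢x , (λ { (_ , _ , exp) → ¬x~p (x∈H , p∈H , exp) }) , z , (tt , tt , exz) , (tt , tt , ezp)

  survivor⇒bad : ∀ {p} → Far p → HV E x p → ¬ GoodComp E x p
  survivor⇒bad {p} pFar (_ , ∉N[A*]) good = ∉N[A*] (inj₁ (p , good , here pFar tt))

  module AroundFar (no6 : ¬ HasCycle E 6) (no7 : ¬ HasCycle E 7)
                   {a : Fin n} (aFar : Far a) (common : ManyCommon a) where

    -- There is no path a – w – q inside N₂(x) with q ≠ a: with z ∈ N(x)
    -- adjacent to q and a common neighbour t ≠ z of x and a, x t a w q z
    -- would be a 6-cycle.
    no-far-path : ∀ {w q} → Far w → Far q → E a w → E w q → q ≢ a → ⊥
    no-far-path {w} {q} wFar qFar eaw ewq q≢a with far-contact qFar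
    ... | z , exz , ezq with common z z
    ...   | t , ext , eat , t≢z , _ = no6 (closedWalk⇒cycle x (t ∷ a ∷ w ∷ q ∷ z ∷ [])
      ((adj⇒≢ ext ∷ x≢far aFar ∷ x≢far wFar ∷ x≢far qFar ∷ adj⇒≢ exz ∷ []) ∷
       (near≢far ext aFar ∷ near≢far ext wFar ∷ near≢far ext qFar ∷ t≢z ∷ []) ∷
       (adj⇒≢ eaw ∷ ≢-sym q≢a ∷ far≢near aFar exz ∷ []) ∷
       (adj⇒≢ ewq ∷ far≢near wFar exz ∷ []) ∷
       (far≢near qFar exz ∷ []) ∷ [] ∷ [])
      (ext ∷ E-sym eat ∷ eaw ∷ ewq ∷ E-sym ezq ∷ [-])
      (E-sym exz))

    component-star : ∀ {r} → CompG E x a r → r ≡ a ⊎ E a r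
    component-star (here _ _) = inj₁ refl
    component-star (step {v = q} cw (_ , _ , ewq) qFar) with component-star cw | q ≟ a
    ... | _         | yes q≡a = inj₁ q≡a
    ... | inj₁ refl | no _    = inj₂ ewq
    ... | inj₂ eaw  | no q≢a  = ⊥-elim (no-far-path (reach-end cw) qFar eaw ewq q≢a)

    shared⇒good : ∀ {p v₁} → Far p → E p a → E x v₁ → E a v₁ → E p v₁ → GoodComp E x a
    shared⇒good {p} {v₁} pFar epa exv₁ eav₁ epv₁ = good-by-root aFar a-sees
      where
      -- a vertex v ≠ v₁ of N(x) adjacent to p gives the 6-cycle x v p v₁ a t
      p-sees-only-v₁ : ∀ {v} → E x v → E p v → v ≢ v₁ → ⊥
      p-sees-only-v₁ {v} exv epv v≢v₁ with common v v₁
      ... | t , ext , eat , t≢v , t≢v₁ = no6 (closedWalk⇒cycle x (v ∷ p ∷ v₁ ∷ a ∷ t ∷ [])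
        ((adj⇒≢ exv ∷ x≢far pFar ∷ adj⇒≢ exv₁ ∷ x≢far aFar ∷ adj⇒≢ ext ∷ []) ∷
         (near≢far exv pFar ∷ v≢v₁ ∷ near≢far exv aFar ∷ ≢-sym t≢v ∷ []) ∷
         (far≢near pFar exv₁ ∷ adj⇒≢ epa ∷ far≢near pFar ext ∷ []) ∷
         (near≢far exv₁ aFar ∷ ≢-sym t≢v₁ ∷ []) ∷
         (far≢near aFar ext ∷ []) ∷ [] ∷ [])
        (exv ∷ E-sym epv ∷ epv₁ ∷ E-sym eav₁ ∷ eat ∷ [-])
        (E-sym ext))

      -- a leaf r ≠ p of the star adjacent to v ≠ v₁ in N(x) gives the 6-cycle x v₁ p a r v
      leaf-sees-only-v₁ : ∀ {v r} → E x v → Far r → E a r → E r v → p ≢ r → v ≢ v₁ → ⊥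
      leaf-sees-only-v₁ {v} {r} exv rFar ear erv p≢r v≢v₁ = no6 (closedWalk⇒cycle x (v₁ ∷ p ∷ a ∷ r ∷ v ∷ [])
        ((adj⇒≢ exv₁ ∷ x≢far pFar ∷ x≢far aFar ∷ x≢far rFar ∷ adj⇒≢ exv ∷ []) ∷
         (near≢far exv₁ pFar ∷ near≢far exv₁ aFar ∷ near≢far exv₁ rFar ∷ ≢-sym v≢v₁ ∷ []) ∷
         (adj⇒≢ epa ∷ p≢r ∷ far≢near pFar exv ∷ []) ∷
         (adj⇒≢ ear ∷ far≢near aFar exv ∷ []) ∷
         (far≢near rFar exv ∷ []) ∷ [] ∷ [])
        (exv₁ ∷ E-sym epv₁ ∷ epa ∷ ear ∷ erv ∷ [-])
        (E-sym exv))

      a-sees : ∀ {v r} → E x v → CompG E x a r → E r v → E a v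
      a-sees {v} {r} exv ar erv with component-star ar | v ≟ v₁
      ... | inj₁ refl | _        = erv
      ... | inj₂ _    | yes refl = eav₁
      ... | inj₂ ear  | no v≢v₁ with p ≟ r
      ...   | yes refl = ⊥-elim (p-sees-only-v₁ exv erv v≢v₁)
      ...   | no p≢r   = ⊥-elim (leaf-sees-only-v₁ exv (reach-end ar) ear erv p≢r v≢v₁)

    -- (3) Let v₁ be a common neighbour of x and a.  We show that v₁ is the
    -- only vertex of N(x) seen by the component of any y ≠ a adjacent to v₁.
    SeesOnly : Fin n → Fin n → Set
    SeesOnly v₁ p = ∀ {w} → E x w → E p w → w ≡ v₁

    -- Base: a neighbour w ≠ v₁ of y in N(x) gives the 6-cycle x t a v₁ y w.
    sees-only-root : ∀ {y v₁} → Far y → y ≢ a → E y v₁ → E x v₁ → E a v₁ → SeesOnly v₁ y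
    sees-only-root {y} {v₁} yFar y≢a eyv₁ exv₁ eav₁ {w} exw eyw with w ≟ v₁
    ... | yes w≡v₁ = w≡v₁
    ... | no w≢v₁ with common w v₁
    ...   | t , ext , eat , t≢w , t≢v₁ = ⊥-elim (no6 (closedWalk⇒cycle x (t ∷ a ∷ v₁ ∷ y ∷ w ∷ [])
      ((adj⇒≢ ext ∷ x≢far aFar ∷ adj⇒≢ exv₁ ∷ x≢far yFar ∷ adj⇒≢ exw ∷ []) ∷
       (near≢far ext aFar ∷ t≢v₁ ∷ near≢far ext yFar ∷ t≢w ∷ []) ∷
       (far≢near aFar exv₁ ∷ ≢-sym y≢a ∷ far≢near aFar exw ∷ []) ∷
       (near≢far exv₁ yFar ∷ ≢-sym w≢v₁ ∷ []) ∷
       (far≢near yFar exw ∷ []) ∷ [] ∷ [])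
      (ext ∷ E-sym eat ∷ eav₁ ∷ E-sym eyv₁ ∷ eyw ∷ [-])
      (E-sym exw)))

    sees-only⇒adjacent : ∀ {p v₁} → Far p → SeesOnly v₁ p → E p v₁
    sees-only⇒adjacent pFar only with far-contact pFar
    ... | z , exz , ezp = subst (E _) (only exz (E-sym ezp)) (E-sym ezp)

    sees-only⇒≢a : ∀ {p v₁} → SeesOnly v₁ p → p ≢ a
    sees-only⇒≢a {v₁ = v₁} only refl with common v₁ v₁
    ... | t , ext , eat , t≢v₁ , _ = t≢v₁ (only ext eat)

    -- Step: if the component of a is not good, the property passes from p
    -- to a neighbour q ∈ N₂(x) of p.  For q = a this contradicts (2); else a
    -- neighbour w ≠ v₁ of q in N(x) gives the 7-cycle x t a v₁ p q w.
    sees-only-step : ¬ GoodComp E x a → ∀ {p q v₁} → E x v₁ → E a v₁ →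
      Far p → SeesOnly v₁ p → Far q → E p q → SeesOnly v₁ q
    sees-only-step bad {p} {q} {v₁} exv₁ eav₁ pFar p-only qFar epq {w} exw eqw with w ≟ v₁ | q ≟ a
    ... | yes w≡v₁ | _        = w≡v₁
    ... | no _     | yes refl = ⊥-elim (bad (shared⇒good pFar epq exv₁ eav₁ (sees-only⇒adjacent pFar p-only)))
    ... | no w≢v₁  | no q≢a with common w v₁
    ...   | t , ext , eat , t≢w , t≢v₁ = ⊥-elim (no7 (closedWalk⇒cycle x (t ∷ a ∷ v₁ ∷ p ∷ q ∷ w ∷ [])
      ((adj⇒≢ ext ∷ x≢far aFar ∷ adj⇒≢ exv₁ ∷ x≢far pFar ∷ x≢far qFar ∷ adj⇒≢ exw ∷ []) ∷
       (near≢far ext aFar ∷ t≢v₁ ∷ near≢far ext pFar ∷ near≢far ext qFar ∷ t≢w ∷ []) ∷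
       (far≢near aFar exv₁ ∷ ≢-sym (sees-only⇒≢a p-only) ∷ ≢-sym q≢a ∷ far≢near aFar exw ∷ []) ∷
       (near≢far exv₁ pFar ∷ near≢far exv₁ qFar ∷ ≢-sym w≢v₁ ∷ []) ∷
       (adj⇒≢ epq ∷ far≢near pFar exw ∷ []) ∷
       (far≢near qFar exw ∷ []) ∷ [] ∷ [])
      (ext ∷ E-sym eat ∷ eav₁ ∷ E-sym (sees-only⇒adjacent pFar p-only) ∷ epq ∷ eqw ∷ [-])
      (E-sym exw)))

    neighbour-of-common⇒good : ¬ GoodComp E x a → ∀ {y v₁} → Far y → y ≢ a →
      E y v₁ → E x v₁ → E a v₁ → GoodComp E x y
    neighbour-of-common⇒good bad {y} {v₁} yFar y≢a eyv₁ exv₁ eav₁ =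
      good-by-root yFar (λ exv yr erv → subst (E y) (sym (sees-only yr exv erv)) eyv₁)
      where
      sees-only : ∀ {r} → CompG E x y r → SeesOnly v₁ r
      sees-only (here _ _)                 = sees-only-root yFar y≢a eyv₁ exv₁ eav₁
      sees-only (step yp (_ , _ , epq) qFar) =
        sees-only-step bad exv₁ eav₁ (reach-end yp) (sees-only yp) qFar epq

lemma8 : (n : ℕ) (G : Graph n) →
    ¬ HasCycle (Graph.E G) 6 → ¬ HasCycle (Graph.E G) 7 →
    (x : Fin n) (A : Fin n → Set) →
    IsComponent (HV (Graph.E G) x) (Graph.E G) (N2 (HV (Graph.E G) x) (Graph.E G) x) A →
    (a b : Fin n) → A a → A b → Adj (HV (Graph.E G) x) (Graph.E G) a b →
    (k : ℕ) (v : Fin k → Fin n) → Injective _≡_ _≡_ v →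
    (∀ y → (Nbr (HV (Graph.E G) x) (Graph.E G) (_≡ a) y × Nbr (HV (Graph.E G) x) (Graph.E G) (_≡ x) y)
           ⇔ (∃ λ i → v i ≡ y)) →
    2 < k →
    ∀ y → (Nbr (HV (Graph.E G) x) (Graph.E G) (λ z → ∃ λ i → v i ≡ z) y × N2 (HV (Graph.E G) x) (Graph.E G) x y)
          ⇔ (y ≡ a)
lemma8 _ G no6 no7 x _ (_ , _ , _ , A⇔reach) a _ a∈A _ _ k v v-inj v⇔common 2<k y =
  mk⇔ only-a a-qualifies
  where
  open Graph G using (E) renaming (sym to E-sym)
  open Around G x

  aH : N2 (HV E x) E x a
  aH = reach-end (Equivalence.to (A⇔reach a) a∈A)
  aFar : Far a
  aFar = far-in-G aH
  bad : ¬ GoodComp E x a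
  bad = survivor⇒bad aFar (proj₁ aH)

  vᵢ-common : ∀ i → HV E x (v i) × E x (v i) × E a (v i)
  vᵢ-common i with Equivalence.from (v⇔common (v i)) (i , refl)
  ... | (vᵢ∈H , _ , _ , refl , (_ , _ , eavᵢ)) , (_ , _ , _ , refl , (_ , _ , exvᵢ)) = vᵢ∈H , exvᵢ , eavᵢ

  common : ManyCommon a
  common α β with avoid-two v v-inj 2<k α β
  ... | i , vᵢ≢α , vᵢ≢β = v i , proj₁ (proj₂ (vᵢ-common i)) , proj₂ (proj₂ (vᵢ-common i)) , vᵢ≢α , vᵢ≢β

  open AroundFar no6 no7 aFar common

  only-a : Nbr (HV E x) E (λ z → ∃ λ i → v i ≡ z) y × N2 (HV E x) E x y → y ≡ a
  only-a ((_ , _ , _ , (i , refl) , (_ , _ , evᵢy)) , yH) with y ≟ a | vᵢ-common i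
  ... | yes y≡a | _ = y≡a
  ... | no y≢a  | _ , exvᵢ , eavᵢ = ⊥-elim (survivor⇒bad (far-in-G yH) (proj₁ yH)
    (neighbour-of-common⇒good bad (far-in-G yH) y≢a (E-sym evᵢy) exvᵢ eavᵢ))

  a-qualifies : y ≡ a → Nbr (HV E x) E (λ z → ∃ λ i → v i ≡ z) y × N2 (HV E x) E x y
  a-qualifies refl with vᵢ-common (fromℕ< (≤-trans (s≤s z≤n) 2<k))
  ... | v₀∈H , _ , eav₀ = (proj₁ aH , a∉v , _ , (_ , refl) , (v₀∈H , proj₁ aH , E-sym eav₀)) , aH
    where
    a∉v : ¬ ∃ λ i → v i ≡ a
    a∉v (i , refl) = far⇒¬near aFar (proj₁ (proj₂ (vᵢ-common i)))
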